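{- Let $\ell\geq 3$ be an integer and let $G$ be a graph with girth exactly $2\ell$ and no even hole of length at least $2\ell+2$. Then $G$ has no induced subgraph which is isomorphic to a subdivision of $K_4$ and all four of whose face cycles have even length.
   Context: A hole is an induced cycle of length at least four. For a graph $H$ isomorphic to a subdivision of $K_4$, the face cycles of $H$ are the four cycles of $H$ corresponding to the four triangles of $K_4$. -}

module Defs where

open import Data.Nat using (ℕ; zero; suc; _+_; _*_; _∸_; _≤_; _<_)
open import Data.Nat.Divisibility using (_∣_)
import Data.Fin
open import Data.Fin using (Fin; toℕ)
open import Data.Product using (Σ; _×_; ∃)
open import Data.Sum using (_⊎_)
open import Data.Empty using (⊥)
open import Relation.Nullary using (¬_)
open import Relation.Binary.PropositionalEquality using (_≡_)
open import Function.Definitions using (Injective)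
open import Function.Bundles using (_⇔_)

record Graph (n : ℕ) : Set₁ where
  field
    _~_   : Fin n → Fin n → Set
    sym   : ∀ {x y} → x ~ y → y ~ x
    irrefl : ∀ {x} → ¬ (x ~ x)

open Graph public

Even : ℕ → Set
Even k = 2 ∣ k

CycNext : (k : ℕ) → Fin k → Fin k → Set
CycNext k i j = (suc (toℕ i) ≡ toℕ j) ⊎ ((suc (toℕ i) ≡ k) × (toℕ j ≡ 0))

record Cycle {n : ℕ} (G : Graph n) (k : ℕ) : Set where
  field
    len≥3 : 3 ≤ k
    vert  : Fin k → Fin n
    inj   : Injective _≡_ _≡_ vert
    edges : ∀ i j → CycNext k i j → _~_ G (vert i) (vert j)

open Cycle public

Induced : {n k : ℕ} {G : Graph n} → Cycle G k → Set
Induced {n} {k} {G} C =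
  ∀ i j → _~_ G (vert C i) (vert C j) → CycNext k i j ⊎ CycNext k j i

Hole : {n : ℕ} → Graph n → ℕ → Set
Hole G k = 4 ≤ k × Σ (Cycle G k) Induced

GirthEq : {n : ℕ} → Graph n → ℕ → Set
GirthEq G g = Cycle G g × (∀ k → Cycle G k → g ≤ k)

data K4Edge : Set where
  e01 e02 e03 e12 e13 e23 : K4Edge

src tgt : K4Edge → Fin 4
src e01 = Data.Fin.zero
src e02 = Data.Fin.zero
src e03 = Data.Fin.zero
src e12 = Data.Fin.suc Data.Fin.zero
src e13 = Data.Fin.suc Data.Fin.zero
src e23 = Data.Fin.suc (Data.Fin.suc Data.Fin.zero)
tgt e01 = Data.Fin.suc Data.Fin.zero
tgt e02 = Data.Fin.suc (Data.Fin.suc Data.Fin.zero)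
tgt e03 = Data.Fin.suc (Data.Fin.suc (Data.Fin.suc Data.Fin.zero))
tgt e12 = Data.Fin.suc (Data.Fin.suc Data.Fin.zero)
tgt e13 = Data.Fin.suc (Data.Fin.suc (Data.Fin.suc Data.Fin.zero))
tgt e23 = Data.Fin.suc (Data.Fin.suc (Data.Fin.suc Data.Fin.zero))

-- A subdivision of K4 is determined (up to isomorphism) by the lengths
-- (numbers of edges, each ≥ 1) of the six paths replacing the edges of K4.
-- Its vertices: the four branch vertices, and for each edge e the interior
-- vertices at positions 1 .. len e - 1 along the path from src e to tgt e.
data SPoint (len : K4Edge → ℕ) : Set where
  br  : Fin 4 → SPoint len
  mid : (e : K4Edge) (i : ℕ) → 1 ≤ i → i < len e → SPoint len

data SArc (len : K4Edge → ℕ) : SPoint len → SPoint len → Set where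
  whole : (e : K4Edge) → len e ≡ 1 → SArc len (br (src e)) (br (tgt e))
  first : (e : K4Edge) (p : 1 ≤ 1) (q : 1 < len e) →
          SArc len (br (src e)) (mid e 1 p q)
  step  : (e : K4Edge) (i : ℕ) (p : 1 ≤ i) (q : i < len e)
          (p' : 1 ≤ suc i) (q' : suc i < len e) →
          SArc len (mid e i p q) (mid e (suc i) p' q')
  last  : (e : K4Edge) (i : ℕ) (p : 1 ≤ i) (q : i < len e) → suc i ≡ len e →
          SArc len (mid e i p q) (br (tgt e))

SAdj : (len : K4Edge → ℕ) → SPoint len → SPoint len → Set
SAdj len x y = SArc len x y ⊎ SArc len y x

-- The four face cycles correspond to the four triangles of K4
-- {0,1,2}, {0,1,3}, {0,2,3}, {1,2,3}; their lengths:
faceLength : (K4Edge → ℕ) → Fin 4 → ℕ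
faceLength len Data.Fin.zero = len e01 + len e12 + len e02
faceLength len (Data.Fin.suc Data.Fin.zero) = len e01 + len e13 + len e03
faceLength len (Data.Fin.suc (Data.Fin.suc Data.Fin.zero)) = len e02 + len e23 + len e03
faceLength len (Data.Fin.suc (Data.Fin.suc (Data.Fin.suc Data.Fin.zero))) = len e12 + len e23 + len e13

InducedSubdivK4 : {n : ℕ} → Graph n → (K4Edge → ℕ) → Set
InducedSubdivK4 {n} G len =
  (∀ e → 1 ≤ len e) ×
  Σ (SPoint len → Fin n) λ φ →
    Injective _≡_ _≡_ φ × (∀ x y → (_~_ G (φ x) (φ y) ⇔ SAdj len x y))

HasEvenFacedInducedSubdivK4 : {n : ℕ} → Graph n → Set
HasEvenFacedInducedSubdivK4 G =
  ∃ λ len → InducedSubdivK4 G len × (∀ f → Even (faceLength len f))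

{-# OPTIONS --safe #-}
module Submission where

-- Every face of an induced subdivision of K₄ is an induced cycle, so by the girth and the absence
-- of even holes of length ≥ 2ℓ + 2, every face (being even) has length exactly 2ℓ.  For an edge e
-- of K₄ with opposite edge e′, the two faces through e together traverse the 4-cycle C avoiding e
-- and e′, plus the path Pₑ of e twice: |C| + 2|Pₑ| = 4ℓ, and likewise |C| + 2|Pₑ′| = 4ℓ.  Hence
-- opposite paths are equally long, C is even, and |Pₑ| ≤ ℓ because |C| ≥ 2ℓ.  If |Pₑ| ≥ 2 then C
-- is induced, an even hole, so |C| ≤ 2ℓ and |Pₑ| = ℓ.  So every path has length 1 or ℓ, and no
-- three such numbers add up to the length 2ℓ of a face when ℓ ≥ 3.

open import Defs
open import Data.Nat using (ℕ; _+_; _*_; _≤_)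
open import Relation.Nullary using (¬_)

open import Data.Empty using (⊥)
open import Data.Fin as Fin using (Fin; toℕ; zero; suc)
open import Data.Fin.Properties using (toℕ<n; toℕ-injective)
open import Data.List using (List; []; _∷_; map; length; filter)
open import Data.List.Membership.Propositional using (_∈_)
open import Data.List.Membership.Propositional.Properties using (∈-map⁻; ∈-filter⁺)
import Data.List.Membership.DecPropositional as DecMembership
open import Data.List.Relation.Unary.All as All using (All; []; _∷_)
open import Data.List.Relation.Unary.AllPairs using (_∷_)
open import Data.List.Relation.Unary.Any using (here; there)
open import Data.List.Relation.Unary.Unique.Propositional using (Unique)
open import Data.List.Relation.Unary.Unique.Propositional.Properties using (Unique[x∷xs]⇒x∉xs)
import Data.List.Relation.Unary.Unique.DecPropositional as DecUnique
open import Data.Nat using (zero; suc; _∸_; _<_; _≮_; z≤n; s≤s; _≤?_; _<?_)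
open import Data.Nat.Divisibility using (_∣_; ∣m+n∣m⇒∣n; ∣m∣n⇒∣m+n; m∣m*n; ∣1⇒≡1)
open import Data.Nat.Properties
open import Algebra.Properties.CommutativeSemigroup +-commutativeSemigroup using (xy∙z≈xz∙y; xy∙z≈zx∙y)
open import Data.Nat.Tactic.RingSolver using (solve-∀)
open import Data.Product using (∃₂; _×_; _,_)
open import Data.Sum using (_⊎_; inj₁; inj₂; [_,_]; swap)
open import Function using (_∘_)
open import Function.Bundles using (_⇔_; Equivalence)
open import Function.Definitions using (Injective)
open import Relation.Binary.Definitions using (DecidableEquality)
open import Relation.Binary.PropositionalEquality as ≡
  using (_≡_; _≢_; refl; cong; cong₂; subst; trans; module ≡-Reasoning)
open import Relation.Nullary using (Dec; yes; no; contradiction)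
open import Relation.Nullary.Decidable using (True; toWitness; map′; _×-dec_; ¬?)

m<n+o⇒m∸n<o′ : ∀ {m n o} → m ≮ n → m < n + o → m ∸ n < o
m<n+o⇒m∸n<o′ {m} {n} {o} m≮n m<n+o = subst (m ∸ n <_) (m+n∸m≡n n o) (∸-monoˡ-< m<n+o (≮⇒≥ m≮n))

2∤1+2n : ∀ n → ¬ Even (suc (2 * n))
2∤1+2n n 2∣1+2n with ∣1⇒≡1 (∣m+n∣m⇒∣n (subst (2 ∣_) (+-comm 1 (2 * n)) 2∣1+2n) (m∣m*n n))
... | ()

even∧≱⇒≤ : ∀ {ℓ k} → Even k → ¬ (2 * ℓ + 2 ≤ k) → k ≤ 2 * ℓ
even∧≱⇒≤ {ℓ} {k} k-even k≱ with k ≤? 2 * ℓ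
... | yes k≤2ℓ = k≤2ℓ
... | no k≰2ℓ with m≤n⇒m<n∨m≡n (≰⇒> k≰2ℓ)
...   | inj₁ 2ℓ+1<k = contradiction (subst (_≤ k) (+-comm 2 (2 * ℓ)) 2ℓ+1<k) k≱
...   | inj₂ refl   = contradiction k-even (2∤1+2n ℓ)

-- p and q are the lengths of two opposite paths, S the length of the 4-cycle avoiding both.
one-or-ℓ : ∀ {ℓ p q S} → 1 ≤ p → 2 * p + S ≡ 2 * ℓ + 2 * ℓ → 2 * q + S ≡ 2 * ℓ + 2 * ℓ →
           2 * ℓ ≤ S → (2 ≤ p → 2 ≤ q → Even S → S ≤ 2 * ℓ) → p ≡ 1 ⊎ p ≡ ℓ
one-or-ℓ {ℓ} {p} {q} {S} 1≤p p-sum q-sum 2ℓ≤S short with p ≤? 1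
... | yes p≤1 = inj₁ (≤-antisym p≤1 1≤p)
... | no p≰1  = inj₂ (≤-antisym p≤ℓ ℓ≤p)
  where
  open ≤-Reasoning
  p≡q : p ≡ q
  p≡q = *-cancelˡ-≡ p q 2 (+-cancelʳ-≡ S (2 * p) (2 * q) (trans p-sum (≡.sym q-sum)))
  S-even : Even S
  S-even = ∣m+n∣m⇒∣n (subst (2 ∣_) (≡.sym p-sum) (∣m∣n⇒∣m+n (m∣m*n ℓ) (m∣m*n ℓ))) (m∣m*n p)
  p≤ℓ : p ≤ ℓ
  p≤ℓ = *-cancelˡ-≤ 2 (+-cancelʳ-≤ (2 * ℓ) (2 * p) (2 * ℓ) (begin
    2 * p + 2 * ℓ  ≤⟨ +-monoʳ-≤ (2 * p) 2ℓ≤S ⟩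
    2 * p + S      ≡⟨ p-sum ⟩
    2 * ℓ + 2 * ℓ  ∎))
  ℓ≤p : ℓ ≤ p
  ℓ≤p = *-cancelˡ-≤ 2 (+-cancelʳ-≤ (2 * ℓ) (2 * ℓ) (2 * p) (begin
    2 * ℓ + 2 * ℓ  ≡⟨ p-sum ⟨
    2 * p + S      ≤⟨ +-monoʳ-≤ (2 * p) (short (≰⇒> p≰1) (subst (2 ≤_) p≡q (≰⇒> p≰1)) S-even) ⟩
    2 * p + 2 * ℓ  ∎))

1+1+c≢2*ℓ : ∀ {ℓ c} → 3 ≤ ℓ → c ≤ ℓ → 1 + 1 + c ≢ 2 * ℓ
1+1+c≢2*ℓ {ℓ} {c} 3≤ℓ c≤ℓ eq = <-irrefl eq (begin-strict
  1 + 1 + c  ≤⟨ +-monoʳ-≤ 2 c≤ℓ ⟩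
  2 + ℓ      <⟨ +-monoˡ-< ℓ 3≤ℓ ⟩
  ℓ + ℓ      ≡⟨ cong (ℓ +_) (+-identityʳ ℓ) ⟨
  2 * ℓ      ∎)
  where open ≤-Reasoning

ℓ+ℓ+c≢2*ℓ : ∀ {ℓ c} → 1 ≤ c → ℓ + ℓ + c ≢ 2 * ℓ
ℓ+ℓ+c≢2*ℓ {ℓ} {c} 1≤c eq = <-irrefl (≡.sym eq) (begin-strict
  2 * ℓ      ≡⟨ cong (ℓ +_) (+-identityʳ ℓ) ⟩
  ℓ + ℓ      <⟨ m<m+n (ℓ + ℓ) 1≤c ⟩
  ℓ + ℓ + c  ∎)
  where open ≤-Reasoning

one-or-ℓ-sum≢2*ℓ : ∀ {ℓ x y z} → 3 ≤ ℓ → x ≡ 1 ⊎ x ≡ ℓ → y ≡ 1 ⊎ y ≡ ℓ → z ≡ 1 ⊎ z ≡ ℓ →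
                   x + y + z ≢ 2 * ℓ
one-or-ℓ-sum≢2*ℓ {ℓ} 3≤ℓ (inj₁ refl) (inj₁ refl) (inj₁ refl) = 1+1+c≢2*ℓ 3≤ℓ (≤-trans (s≤s z≤n) 3≤ℓ)
one-or-ℓ-sum≢2*ℓ {ℓ} 3≤ℓ (inj₁ refl) (inj₁ refl) (inj₂ refl) = 1+1+c≢2*ℓ 3≤ℓ ≤-refl
one-or-ℓ-sum≢2*ℓ {ℓ} 3≤ℓ (inj₁ refl) (inj₂ refl) (inj₁ refl) = 1+1+c≢2*ℓ 3≤ℓ ≤-refl ∘ trans (xy∙z≈xz∙y 1 1 ℓ)
one-or-ℓ-sum≢2*ℓ {ℓ} 3≤ℓ (inj₂ refl) (inj₁ refl) (inj₁ refl) = 1+1+c≢2*ℓ 3≤ℓ ≤-refl ∘ trans (xy∙z≈zx∙y 1 1 ℓ)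
one-or-ℓ-sum≢2*ℓ {ℓ} 3≤ℓ (inj₂ refl) (inj₂ refl) (inj₁ refl) = ℓ+ℓ+c≢2*ℓ {ℓ} ≤-refl
one-or-ℓ-sum≢2*ℓ {ℓ} 3≤ℓ (inj₂ refl) (inj₂ refl) (inj₂ refl) = ℓ+ℓ+c≢2*ℓ {ℓ} (≤-trans (s≤s z≤n) 3≤ℓ)
one-or-ℓ-sum≢2*ℓ {ℓ} 3≤ℓ (inj₂ refl) (inj₁ refl) (inj₂ refl) = ℓ+ℓ+c≢2*ℓ {ℓ} ≤-refl ∘ trans (xy∙z≈xz∙y ℓ ℓ 1)
one-or-ℓ-sum≢2*ℓ {ℓ} 3≤ℓ (inj₁ refl) (inj₂ refl) (inj₂ refl) = ℓ+ℓ+c≢2*ℓ {ℓ} ≤-refl ∘ trans (xy∙z≈zx∙y ℓ ℓ 1)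

-- Cycles of K₄

data Dart : Set where
  fw bw : K4Edge → Dart

edge : Dart → K4Edge
edge (fw e) = e
edge (bw e) = e

tail head : Dart → Fin 4
tail (fw e) = src e
tail (bw e) = tgt e
head (fw e) = tgt e
head (bw e) = src e

edgeIndex : K4Edge → ℕ
edgeIndex e01 = 0
edgeIndex e02 = 1
edgeIndex e03 = 2
edgeIndex e12 = 3
edgeIndex e13 = 4
edgeIndex e23 = 5

edgeOfIndex : ℕ → K4Edge
edgeOfIndex 0 = e01
edgeOfIndex 1 = e02
edgeOfIndex 2 = e03
edgeOfIndex 3 = e12
edgeOfIndex 4 = e13
edgeOfIndex _ = e23

edgeOfIndex-edgeIndex : ∀ e → edgeOfIndex (edgeIndex e) ≡ e
edgeOfIndex-edgeIndex e01 = refl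
edgeOfIndex-edgeIndex e02 = refl
edgeOfIndex-edgeIndex e03 = refl
edgeOfIndex-edgeIndex e12 = refl
edgeOfIndex-edgeIndex e13 = refl
edgeOfIndex-edgeIndex e23 = refl

edgeIndex-injective : Injective _≡_ _≡_ edgeIndex
edgeIndex-injective {e} {e′} eq =
  trans (≡.sym (edgeOfIndex-edgeIndex e)) (trans (cong edgeOfIndex eq) (edgeOfIndex-edgeIndex e′))

_≟ᴱ_ : DecidableEquality K4Edge
e ≟ᴱ e′ = map′ edgeIndex-injective (cong edgeIndex) (edgeIndex e ≟ edgeIndex e′)

_≟ⱽ_ : DecidableEquality (Fin 4)
_≟ⱽ_ = Fin._≟_

open DecMembership _≟ᴱ_ using () renaming (_∈?_ to _∈ᴱ?_)
open DecMembership _≟ⱽ_ using () renaming (_∈?_ to _∈ⱽ?_)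

allEdges : List K4Edge
allEdges = e01 ∷ e02 ∷ e03 ∷ e12 ∷ e13 ∷ e23 ∷ []

∈-allEdges : ∀ e → e ∈ allEdges
∈-allEdges e01 = here refl
∈-allEdges e02 = there (here refl)
∈-allEdges e03 = there (there (here refl))
∈-allEdges e12 = there (there (there (here refl)))
∈-allEdges e13 = there (there (there (there (here refl))))
∈-allEdges e23 = there (there (there (there (there (here refl)))))

Chain : Fin 4 → Fin 4 → List Dart → Set
Chain u v []       = u ≡ v
Chain u v (d ∷ ds) = u ≡ tail d × Chain (head d) v ds

chain? : ∀ u v ds → Dec (Chain u v ds)
chain? u v []       = u ≟ⱽ v
chain? u v (d ∷ ds) = (u ≟ⱽ tail d) ×-dec chain? (head d) v ds

IsRoute : Fin 4 → List Dart → Set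
IsRoute v ds = Chain v v ds × 3 ≤ length ds × Unique (map tail ds) × Unique (map edge ds)

isRoute? : ∀ v ds → Dec (IsRoute v ds)
isRoute? v ds = chain? v v ds ×-dec 3 ≤? length ds
  ×-dec DecUnique.unique? _≟ⱽ_ (map tail ds) ×-dec DecUnique.unique? _≟ᴱ_ (map edge ds)

record Route : Set where
  field
    base         : Fin 4
    darts        : List Dart
    closed       : Chain base base darts
    3≤length     : 3 ≤ length darts
    tails-unique : Unique (map tail darts)
    edges-unique : Unique (map edge darts)

route : (v : Fin 4) (ds : List Dart) → {True (isRoute? v ds)} → Route
route v ds {valid} =
  let closed , 3≤length , tails-unique , edges-unique = toWitness valid in
  record { base = v ; darts = ds ; closed = closed ; 3≤length = 3≤length
         ; tails-unique = tails-unique ; edges-unique = edges-unique }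

Chord : List Dart → K4Edge → Set
Chord ds e = src e ∈ map tail ds × tgt e ∈ map tail ds × ¬ e ∈ map edge ds

chord? : ∀ ds e → Dec (Chord ds e)
chord? ds e = (src e ∈ⱽ? map tail ds) ×-dec (tgt e ∈ⱽ? map tail ds) ×-dec ¬? (e ∈ᴱ? map edge ds)

chords : List Dart → List K4Edge
chords ds = filter (chord? ds) allEdges

on-route-or-subdivided : ∀ {len : K4Edge → ℕ} {ds e} → All (λ c → 2 ≤ len c) (chords ds) →
                   src e ∈ map tail ds → tgt e ∈ map tail ds → e ∈ map edge ds ⊎ 2 ≤ len e
on-route-or-subdivided {ds = ds} {e} chords-subdivided src∈ tgt∈ with e ∈ᴱ? map edge ds
... | yes e∈ = inj₁ e∈
... | no e∉  = inj₂ (All.lookup chords-subdivided (∈-filter⁺ (chord? ds) (∈-allEdges e) (src∈ , tgt∈ , e∉)))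

routeLength : (K4Edge → ℕ) → List Dart → ℕ
routeLength len []       = 0
routeLength len (d ∷ ds) = len (edge d) + routeLength len ds

-- Walking along a route in the subdivision

-- CycNext k i j unfolds to Next k (toℕ i) (toℕ j).
Next : ℕ → ℕ → ℕ → Set
Next k i j = suc i ≡ j ⊎ (suc i ≡ k × j ≡ 0)

module Subdivision (len : K4Edge → ℕ) (len≥1 : ∀ e → 1 ≤ len e) where

  point : K4Edge → ℕ → SPoint len
  point e zero = br (src e)
  point e (suc i) with suc i <? len e
  ... | yes i<len = mid e (suc i) (s≤s z≤n) i<len
  ... | no _      = br (tgt e)

  point-mid : ∀ {e i} (p : 1 ≤ i) (q : i < len e) → point e i ≡ mid e i p q
  point-mid {e} {suc i} p q with suc i <? len e
  ... | yes _    = cong₂ (mid e (suc i)) (≤-irrelevant _ _) (≤-irrelevant _ _)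
  ... | no i≮len = contradiction q i≮len

  point-beyond : ∀ e {i} → len e ≤ i → point e i ≡ br (tgt e)
  point-beyond e {zero}  len≤0 = contradiction len≤0 (<⇒≱ (len≥1 e))
  point-beyond e {suc i} len≤i with suc i <? len e
  ... | yes i<len = contradiction len≤i (<⇒≱ i<len)
  ... | no _      = refl

  point-arc : ∀ {e t} → t < len e → SArc len (point e t) (point e (suc t))
  point-arc {e} {zero} _ with 1 <? len e
  ... | yes 1<len = first e (s≤s z≤n) 1<len
  ... | no 1≮len  = whole e (≤-antisym (≮⇒≥ 1≮len) (len≥1 e))
  point-arc {e} {suc t} t<len with suc t <? len e | suc (suc t) <? len e
  ... | yes t<len′ | yes t+1<len = step e (suc t) (s≤s z≤n) t<len′ (s≤s z≤n) t+1<len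
  ... | yes t<len′ | no t+1≮len  = last e (suc t) (s≤s z≤n) t<len′ (≤-antisym t<len′ (≮⇒≥ t+1≮len))
  ... | no t≮len   | _           = contradiction t<len t≮len

  arc-points : ∀ {x y} → SArc len x y → ∃₂ λ e t → t < len e × x ≡ point e t × y ≡ point e (suc t)
  arc-points (whole e len≡1)        = e , 0 , len≥1 e , refl , ≡.sym (point-beyond e (≤-reflexive len≡1))
  arc-points (first e p q)          = e , 0 , len≥1 e , refl , ≡.sym (point-mid p q)
  arc-points (step e i p q p′ q′)   = e , i , q , ≡.sym (point-mid p q) , ≡.sym (point-mid p′ q′)
  arc-points (last e i p q i+1≡len) =
    e , i , q , ≡.sym (point-mid p q) , ≡.sym (point-beyond e (≤-reflexive (≡.sym i+1≡len)))

  dlen : Dart → ℕ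
  dlen d = len (edge d)

  edgePosition : Dart → ℕ → ℕ
  edgePosition (fw e) t = t
  edgePosition (bw e) t = len e ∸ t

  along : Dart → ℕ → SPoint len
  along d t = point (edge d) (edgePosition d t)

  edgePosition-involutive : ∀ d {t} → t ≤ dlen d → edgePosition d (edgePosition d t) ≡ t
  edgePosition-involutive (fw e) _     = refl
  edgePosition-involutive (bw e) t≤len = m∸[m∸n]≡n t≤len

  edgePosition-interior : ∀ d {t} → 0 < t → t < dlen d → 1 ≤ edgePosition d t × edgePosition d t < dlen d
  edgePosition-interior (fw e) 0<t t<len = 0<t , t<len
  edgePosition-interior (bw e) 0<t t<len = m<n⇒0<n∸m t<len , ∸-monoʳ-< 0<t (<⇒≤ t<len)

  along-start : ∀ d → along d 0 ≡ br (tail d)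
  along-start (fw e) = refl
  along-start (bw e) = point-beyond e ≤-refl

  along-end : ∀ d → along d (dlen d) ≡ br (head d)
  along-end (fw e) = point-beyond e ≤-refl
  along-end (bw e) = cong (point e) (n∸n≡0 (len e))

  along-adj : ∀ d {t} → t < dlen d → SAdj len (along d t) (along d (suc t))
  along-adj (fw e)     t<len = inj₁ (point-arc t<len)
  along-adj (bw e) {t} t<len =
    inj₂ (subst (SArc len (point e (len e ∸ suc t)) ∘ point e) (≡.sym (+-∸-assoc 1 t<len))
                (point-arc (∸-monoʳ-< (s≤s z≤n) t<len)))

  point-as-bw : ∀ e {s} → s ≤ len e → point e s ≡ along (bw e) (len e ∸ s)
  point-as-bw e s≤len = cong (point e) (≡.sym (m∸[m∸n]≡n s≤len))

  position : Dart → SPoint len → ℕ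
  position d (br _)        = 0
  position d (mid _ i _ _) = edgePosition d i

  position-along : ∀ d {t} → t < dlen d → position d (along d t) ≡ t
  position-along d {zero}  _     = cong (position d) (along-start d)
  position-along d {suc t} t<len =
    let p , q = edgePosition-interior d (s≤s z≤n) t<len
    in trans (cong (position d) (point-mid p q)) (edgePosition-involutive d (<⇒≤ t<len))

  along-injective : ∀ d {s t} → s < dlen d → t < dlen d → along d s ≡ along d t → s ≡ t
  along-injective d s<len t<len eq =
    trans (≡.sym (position-along d s<len)) (trans (cong (position d) eq) (position-along d t<len))

  OnRoute : List Dart → SPoint len → Set
  OnRoute ds (br v)        = v ∈ map tail ds
  OnRoute ds (mid e _ _ _) = e ∈ map edge ds

  OnRoute-there : ∀ {d ds} x → OnRoute ds x → OnRoute (d ∷ ds) x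
  OnRoute-there (br _)        = there
  OnRoute-there (mid _ _ _ _) = there

  OnRoute-shared : ∀ {d ds} x → OnRoute (d ∷ []) x → OnRoute ds x →
                   tail d ∈ map tail ds ⊎ edge d ∈ map edge ds
  OnRoute-shared (br _)        (here refl) v∈ = inj₁ v∈
  OnRoute-shared (mid _ _ _ _) (here refl) e∈ = inj₂ e∈

  along-on : ∀ d ds {t} → t < dlen d → OnRoute (d ∷ ds) (along d t)
  along-on d ds {zero}  _     = subst (OnRoute (d ∷ ds)) (≡.sym (along-start d)) (here refl)
  along-on d ds {suc t} t<len =
    let p , q = edgePosition-interior d (s≤s z≤n) t<len
    in subst (OnRoute (d ∷ ds)) (≡.sym (point-mid p q)) (here refl)

  walk : Fin 4 → List Dart → ℕ → SPoint len
  walk v []       t = br v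
  walk v (d ∷ ds) t with t <? dlen d
  ... | yes _ = along d t
  ... | no _  = walk v ds (t ∸ dlen d)

  walk-start : ∀ {u v ds} → Chain u v ds → walk v ds 0 ≡ br u
  walk-start {ds = []}     u≡v = cong br (≡.sym u≡v)
  walk-start {ds = d ∷ ds} (u≡tail , _) with 0 <? dlen d
  ... | yes _    = trans (along-start d) (cong br (≡.sym u≡tail))
  ... | no 0≮len = contradiction (len≥1 (edge d)) 0≮len

  walk-end : ∀ v ds → walk v ds (routeLength len ds) ≡ br v
  walk-end v []       = refl
  walk-end v (d ∷ ds) with dlen d + routeLength len ds <? dlen d
  ... | yes past = contradiction past (m+n≮m _ _)
  ... | no _     = trans (cong (walk v ds) (m+n∸m≡n (dlen d) _)) (walk-end v ds)

  offset : ∀ {d ds} → d ∈ ds → ℕ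
  offset (here _)                 = 0
  offset {ds = d′ ∷ _} (there d∈) = dlen d′ + offset d∈

  offset-bound : ∀ {d ds} (d∈ : d ∈ ds) → offset d∈ + dlen d ≤ routeLength len ds
  offset-bound {ds = d ∷ ds}  (here refl) = m≤m+n (dlen d) (routeLength len ds)
  offset-bound {ds = d′ ∷ ds} (there d∈)  =
    ≤-trans (≤-reflexive (+-assoc (dlen d′) _ _)) (+-monoʳ-≤ (dlen d′) (offset-bound d∈))

  walk-along : ∀ {u v d ds a} → Chain u v ds → (d∈ : d ∈ ds) → a ≤ dlen d →
               walk v ds (offset d∈ + a) ≡ along d a
  walk-along {v = v} {ds = d ∷ ds} {a} (_ , chain) (here refl) a≤len with a <? dlen d
  ... | yes _    = refl
  ... | no a≮len = begin
    walk v ds (a ∸ dlen d) ≡⟨ cong (walk v ds) (trans (cong (_∸ dlen d) a≡len) (n∸n≡0 (dlen d))) ⟩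
    walk v ds 0            ≡⟨ walk-start chain ⟩
    br (head d)            ≡⟨ along-end d ⟨
    along d (dlen d)       ≡⟨ cong (along d) a≡len ⟨
    along d a              ∎
    where
    open ≡-Reasoning
    a≡len : a ≡ dlen d
    a≡len = ≤-antisym a≤len (≮⇒≥ a≮len)
  walk-along {v = v} {ds = d′ ∷ ds} {a} (_ , chain) (there d∈) a≤len with dlen d′ + offset d∈ + a <? dlen d′
  ... | yes before = contradiction (subst (_< dlen d′) (+-assoc (dlen d′) (offset d∈) a) before) (m+n≮m _ _)
  ... | no _       = trans (cong (walk v ds) skip) (walk-along chain d∈ a≤len)
    where
    skip : dlen d′ + offset d∈ + a ∸ dlen d′ ≡ offset d∈ + a
    skip = trans (cong (_∸ dlen d′) (+-assoc (dlen d′) (offset d∈) a)) (m+n∸m≡n (dlen d′) _)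

  walk-adj : ∀ {u v ds t} → Chain u v ds → t < routeLength len ds → SAdj len (walk v ds t) (walk v ds (suc t))
  walk-adj {v = v} {d ∷ ds} {t} chain@(_ , rest) t<total with t <? dlen d
  ... | yes t<len = subst (SAdj len (along d t)) (≡.sym (walk-along chain (here refl) t<len)) (along-adj d t<len)
  ... | no t≮len with suc t <? dlen d
  ...   | yes t+1<len = contradiction (<-trans (n<1+n t) t+1<len) t≮len
  ...   | no _        =
    subst (SAdj len (walk v ds (t ∸ dlen d)) ∘ walk v ds) (≡.sym (+-∸-assoc 1 (≮⇒≥ t≮len)))
          (walk-adj rest (m<n+o⇒m∸n<o′ t≮len t<total))

  walk-on : ∀ {v ds t} → t < routeLength len ds → OnRoute ds (walk v ds t)
  walk-on {v} {d ∷ ds} {t} t<total with t <? dlen d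
  ... | yes t<len = along-on d ds t<len
  ... | no t≮len  = OnRoute-there (walk v ds (t ∸ dlen d)) (walk-on (m<n+o⇒m∸n<o′ t≮len t<total))

  along≢walk : ∀ {v d ds s t} → Unique (map tail (d ∷ ds)) → Unique (map edge (d ∷ ds)) →
               s < dlen d → t < routeLength len ds → along d s ≢ walk v ds t
  along≢walk {v} {d} {ds} {s} tails-unique edges-unique s<len t<total eq =
    [ Unique[x∷xs]⇒x∉xs tails-unique , Unique[x∷xs]⇒x∉xs edges-unique ]
      (OnRoute-shared (along d s) (along-on d [] s<len) (subst (OnRoute ds) (≡.sym eq) (walk-on {v} t<total)))

  walk-injective : ∀ {v ds s t} → Unique (map tail ds) → Unique (map edge ds) →
                   s < routeLength len ds → t < routeLength len ds → walk v ds s ≡ walk v ds t → s ≡ t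
  walk-injective {v} {d ∷ ds} {s} {t} tails-u@(_ ∷ tails-u′) edges-u@(_ ∷ edges-u′) s<total t<total eq
    with s <? dlen d | t <? dlen d
  ... | yes s<len | yes t<len = along-injective d s<len t<len eq
  ... | yes s<len | no t≮len  =
    contradiction eq (along≢walk {d = d} tails-u edges-u s<len (m<n+o⇒m∸n<o′ t≮len t<total))
  ... | no s≮len  | yes t<len =
    contradiction (≡.sym eq) (along≢walk {d = d} tails-u edges-u t<len (m<n+o⇒m∸n<o′ s≮len s<total))
  ... | no s≮len  | no t≮len  =
    ∸-cancelʳ-≡ (≮⇒≥ s≮len) (≮⇒≥ t≮len)
      (walk-injective tails-u′ edges-u′ (m<n+o⇒m∸n<o′ s≮len s<total) (m<n+o⇒m∸n<o′ t≮len t<total) eq)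

  length≤routeLength : ∀ ds → length ds ≤ routeLength len ds
  length≤routeLength []       = z≤n
  length≤routeLength (d ∷ ds) = +-mono-≤ (len≥1 (edge d)) (length≤routeLength ds)

  module RouteCycle (r : Route) where
    open Route r

    K : ℕ
    K = routeLength len darts

    vertex : ℕ → SPoint len
    vertex = walk base darts

    vertex-injective : ∀ {i j} → i < K → j < K → vertex i ≡ vertex j → i ≡ j
    vertex-injective = walk-injective tails-unique edges-unique

    vertex-wraps : vertex K ≡ vertex 0
    vertex-wraps = trans (walk-end base darts) (≡.sym (walk-start closed))

    vertex-next : ∀ {i j} → i < K → Next K i j → SAdj len (vertex i) (vertex j)
    vertex-next     i<K (inj₁ refl)           = walk-adj closed i<K
    vertex-next {i} i<K (inj₂ (i+1≡K , refl)) =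
      subst (SAdj len (vertex i)) (trans (cong vertex i+1≡K) vertex-wraps) (walk-adj closed i<K)

    vertex-along : ∀ {d i a} (d∈ : d ∈ darts) → a ≤ dlen d → i < K → vertex i ≡ along d a →
                   offset d∈ + a ≡ i ⊎ (offset d∈ + a ≡ K × i ≡ 0)
    vertex-along {d} {i} {a} d∈ a≤len i<K eq
      with m≤n⇒m<n∨m≡n (≤-trans (+-monoʳ-≤ (offset d∈) a≤len) (offset-bound d∈))
    ... | inj₁ o+a<K = inj₁ (vertex-injective o+a<K i<K (trans (walk-along closed d∈ a≤len) (≡.sym eq)))
    ... | inj₂ o+a≡K = inj₂ (o+a≡K , vertex-injective i<K (≤-trans (s≤s z≤n) i<K) wrapped)
      where
      open ≡-Reasoning
      wrapped : vertex i ≡ vertex 0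
      wrapped = begin
        vertex i               ≡⟨ eq ⟩
        along d a              ≡⟨ walk-along closed d∈ a≤len ⟨
        vertex (offset d∈ + a) ≡⟨ cong vertex o+a≡K ⟩
        vertex K               ≡⟨ vertex-wraps ⟩
        vertex 0               ∎

    dart-next : ∀ {d i j a} → d ∈ darts → a < dlen d → i < K → j < K →
                vertex i ≡ along d a → vertex j ≡ along d (suc a) → Next K i j
    dart-next {j = j} {a} d∈ a<len i<K j<K eqᵢ eqⱼ with vertex-along d∈ (<⇒≤ a<len) i<K eqᵢ
    ... | inj₂ (o+a≡K , _) =
      contradiction (≤-trans (+-monoʳ-< (offset d∈) a<len) (offset-bound d∈)) (<-irrefl o+a≡K)
    ... | inj₁ refl =
      subst (λ m → m ≡ j ⊎ (m ≡ K × j ≡ 0)) (+-suc (offset d∈) a) (vertex-along d∈ a<len j<K eqⱼ)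

    on-route : ∀ {i x} → i < K → vertex i ≡ x → OnRoute darts x
    on-route i<K eq = subst (OnRoute darts) eq (walk-on i<K)

    arc-on-route : All (λ c → 2 ≤ len c) (chords darts) → ∀ {i j e t} → i < K → j < K → t < len e →
                   vertex i ≡ point e t → vertex j ≡ point e (suc t) → e ∈ map edge darts
    arc-on-route _ {t = suc t} i<K _ t<len eqᵢ _ = on-route i<K (trans eqᵢ (point-mid (s≤s z≤n) t<len))
    arc-on-route chords-subdivided {e = e} {zero} i<K j<K _ eqᵢ eqⱼ with len e ≤? 1
    ... | no len≰1 = on-route j<K (trans eqⱼ (point-mid (s≤s z≤n) (≰⇒> len≰1)))
    ... | yes len≤1
      with on-route-or-subdivided chords-subdivided (on-route i<K eqᵢ) (on-route j<K (trans eqⱼ (point-beyond e len≤1)))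
    ...   | inj₁ e∈    = e∈
    ...   | inj₂ 1<len = contradiction len≤1 (<⇒≱ 1<len)

    vertex-arc : All (λ c → 2 ≤ len c) (chords darts) → ∀ {i j} → i < K → j < K →
                 SArc len (vertex i) (vertex j) → Next K i j ⊎ Next K j i
    vertex-arc chords-subdivided i<K j<K arc with arc-points arc
    ... | e , t , t<len , eqᵢ , eqⱼ with ∈-map⁻ edge (arc-on-route chords-subdivided i<K j<K t<len eqᵢ eqⱼ)
    ...   | fw e , fw∈ , refl = inj₁ (dart-next fw∈ t<len i<K j<K eqᵢ eqⱼ)
    ...   | bw e , bw∈ , refl =
      inj₂ (dart-next bw∈ (∸-monoʳ-< (s≤s z≤n) t<len) j<K i<K
              (trans eqⱼ (point-as-bw e t<len))
              (trans eqᵢ (trans (point-as-bw e (<⇒≤ t<len)) (cong (along (bw e)) (+-∸-assoc 1 t<len)))))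

    vertex-chordless : All (λ c → 2 ≤ len c) (chords darts) → ∀ {i j} → i < K → j < K →
                       SAdj len (vertex i) (vertex j) → Next K i j ⊎ Next K j i
    vertex-chordless chords-subdivided i<K j<K (inj₁ arc) = vertex-arc chords-subdivided i<K j<K arc
    vertex-chordless chords-subdivided i<K j<K (inj₂ arc) = swap (vertex-arc chords-subdivided j<K i<K arc)

module _ {n} (G : Graph n) {V : Set} {Adj : V → V → Set} {φ : V → Fin n}
         (φ-injective : Injective _≡_ _≡_ φ) (φ-iso : ∀ x y → _~_ G (φ x) (φ y) ⇔ Adj x y) where

  image-cycle : ∀ {k} (w : Fin k → V) → 3 ≤ k → Injective _≡_ _≡_ w →
                (∀ i j → CycNext k i j → Adj (w i) (w j)) → Cycle G k
  image-cycle w 3≤k w-injective w-next = record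
    { len≥3 = 3≤k
    ; vert  = φ ∘ w
    ; inj   = w-injective ∘ φ-injective
    ; edges = λ i j next → Equivalence.from (φ-iso _ _) (w-next i j next)
    }

  image-cycle-induced : ∀ {k} (w : Fin k → V) (3≤k : 3 ≤ k) (w-injective : Injective _≡_ _≡_ w)
    (w-next : ∀ i j → CycNext k i j → Adj (w i) (w j)) →
    (∀ i j → Adj (w i) (w j) → CycNext k i j ⊎ CycNext k j i) → Induced (image-cycle w 3≤k w-injective w-next)
  image-cycle-induced _ _ _ _ w-chordless i j = w-chordless i j ∘ Equivalence.to (φ-iso _ _)

module InducedSubdivision {n} (G : Graph n) (len : K4Edge → ℕ) (len≥1 : ∀ e → 1 ≤ len e)
  {φ : SPoint len → Fin n} (φ-injective : Injective _≡_ _≡_ φ) (φ-iso : ∀ x y → _~_ G (φ x) (φ y) ⇔ SAdj len x y)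
  where
  open Subdivision len len≥1

  module _ (r : Route) where
    open Route r
    open RouteCycle r

    private
      w : Fin K → SPoint len
      w = vertex ∘ toℕ

      3≤K : 3 ≤ K
      3≤K = ≤-trans 3≤length (length≤routeLength darts)

      w-injective : Injective _≡_ _≡_ w
      w-injective eq = toℕ-injective (vertex-injective (toℕ<n _) (toℕ<n _) eq)

      w-next : ∀ i j → CycNext K i j → SAdj len (w i) (w j)
      w-next i _ = vertex-next (toℕ<n i)

    routeCycle : Cycle G K
    routeCycle = image-cycle G φ-injective φ-iso w 3≤K w-injective w-next

    routeCycle-induced : All (λ c → 2 ≤ len c) (chords darts) → Induced routeCycle
    routeCycle-induced chords-subdivided = image-cycle-induced G φ-injective φ-iso w 3≤K w-injective w-next
      (λ i j → vertex-chordless chords-subdivided (toℕ<n i) (toℕ<n j))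

-- Faces and 4-cycles of K₄

triangle : Fin 4 → Route
triangle zero                   = route zero (fw e01 ∷ fw e12 ∷ bw e02 ∷ [])
triangle (suc zero)             = route zero (fw e01 ∷ fw e13 ∷ bw e03 ∷ [])
triangle (suc (suc zero))       = route zero (fw e02 ∷ fw e23 ∷ bw e03 ∷ [])
triangle (suc (suc (suc zero))) = route (suc zero) (fw e12 ∷ fw e23 ∷ bw e13 ∷ [])

opposite : K4Edge → K4Edge
opposite e01 = e23
opposite e02 = e13
opposite e03 = e12
opposite e12 = e03
opposite e13 = e02
opposite e23 = e01

square : K4Edge → Route
square e01 = route zero (fw e02 ∷ bw e12 ∷ fw e13 ∷ bw e03 ∷ [])
square e02 = route zero (fw e01 ∷ fw e12 ∷ fw e23 ∷ bw e03 ∷ [])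
square e03 = route zero (fw e01 ∷ fw e13 ∷ bw e23 ∷ bw e02 ∷ [])
square e12 = square e03
square e13 = square e02
square e23 = square e01

squareLength : (K4Edge → ℕ) → K4Edge → ℕ
squareLength len e = routeLength len (Route.darts (square e))

square-opposite : ∀ e → square (opposite e) ≡ square e
square-opposite e01 = refl
square-opposite e02 = refl
square-opposite e03 = refl
square-opposite e12 = refl
square-opposite e13 = refl
square-opposite e23 = refl

sum₃-reassoc : ∀ a b c → a + (b + (c + 0)) ≡ a + b + c
sum₃-reassoc = solve-∀

triangle-length : ∀ len f → routeLength len (Route.darts (triangle f)) ≡ faceLength len f
triangle-length len zero                   = sum₃-reassoc (len e01) (len e12) (len e02)
triangle-length len (suc zero)             = sum₃-reassoc (len e01) (len e13) (len e03)
triangle-length len (suc (suc zero))       = sum₃-reassoc (len e02) (len e23) (len e03)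
triangle-length len (suc (suc (suc zero))) = sum₃-reassoc (len e12) (len e23) (len e13)

triangle-chordless : ∀ (len : K4Edge → ℕ) f → All (λ c → 2 ≤ len c) (chords (Route.darts (triangle f)))
triangle-chordless len zero                   = []
triangle-chordless len (suc zero)             = []
triangle-chordless len (suc (suc zero))       = []
triangle-chordless len (suc (suc (suc zero))) = []

square-chords : ∀ (len : K4Edge → ℕ) e → 2 ≤ len e → 2 ≤ len (opposite e) →
                All (λ c → 2 ≤ len c) (chords (Route.darts (square e)))
square-chords len e01 2≤len 2≤len′ = 2≤len ∷ 2≤len′ ∷ []
square-chords len e02 2≤len 2≤len′ = 2≤len ∷ 2≤len′ ∷ []
square-chords len e03 2≤len 2≤len′ = 2≤len ∷ 2≤len′ ∷ []
square-chords len e12 2≤len 2≤len′ = 2≤len′ ∷ 2≤len ∷ []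
square-chords len e13 2≤len 2≤len′ = 2≤len′ ∷ 2≤len ∷ []
square-chords len e23 2≤len 2≤len′ = 2≤len′ ∷ 2≤len ∷ []

faces-through : ∀ len e → ∃₂ λ f f′ → faceLength len f + faceLength len f′ ≡ 2 * len e + squareLength len e
faces-through len e01 = zero , suc zero , identity (len e01) (len e02) (len e03) (len e12) (len e13)
  where
  identity : ∀ a01 a02 a03 a12 a13 →
             a01 + a12 + a02 + (a01 + a13 + a03) ≡ 2 * a01 + (a02 + (a12 + (a13 + (a03 + 0))))
  identity = solve-∀
faces-through len e02 = zero , suc (suc zero) , identity (len e01) (len e02) (len e03) (len e12) (len e23)
  where
  identity : ∀ a01 a02 a03 a12 a23 →
             a01 + a12 + a02 + (a02 + a23 + a03) ≡ 2 * a02 + (a01 + (a12 + (a23 + (a03 + 0))))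
  identity = solve-∀
faces-through len e03 = suc zero , suc (suc zero) , identity (len e01) (len e02) (len e03) (len e13) (len e23)
  where
  identity : ∀ a01 a02 a03 a13 a23 →
             a01 + a13 + a03 + (a02 + a23 + a03) ≡ 2 * a03 + (a01 + (a13 + (a23 + (a02 + 0))))
  identity = solve-∀
faces-through len e12 = zero , suc (suc (suc zero)) , identity (len e01) (len e02) (len e12) (len e13) (len e23)
  where
  identity : ∀ a01 a02 a12 a13 a23 →
             a01 + a12 + a02 + (a12 + a23 + a13) ≡ 2 * a12 + (a01 + (a13 + (a23 + (a02 + 0))))
  identity = solve-∀
faces-through len e13 = suc zero , suc (suc (suc zero)) , identity (len e01) (len e03) (len e12) (len e13) (len e23)
  where
  identity : ∀ a01 a03 a12 a13 a23 →
             a01 + a13 + a03 + (a12 + a23 + a13) ≡ 2 * a13 + (a01 + (a12 + (a23 + (a03 + 0))))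
  identity = solve-∀
faces-through len e23 = suc (suc zero) , suc (suc (suc zero)) , identity (len e02) (len e03) (len e12) (len e13) (len e23)
  where
  identity : ∀ a02 a03 a12 a13 a23 →
             a02 + a23 + a03 + (a12 + a23 + a13) ≡ 2 * a23 + (a02 + (a12 + (a13 + (a03 + 0))))
  identity = solve-∀

K4-lengths-impossible : ∀ {ℓ} {len : K4Edge → ℕ} → 3 ≤ ℓ → (∀ e → 1 ≤ len e) →
  (∀ f → faceLength len f ≡ 2 * ℓ) → (∀ e → 2 * ℓ ≤ squareLength len e) →
  (∀ e → 2 ≤ len e → 2 ≤ len (opposite e) → Even (squareLength len e) → squareLength len e ≤ 2 * ℓ) → ⊥
K4-lengths-impossible {ℓ} {len} 3≤ℓ len≥1 face-2ℓ square-long square-short =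
  one-or-ℓ-sum≢2*ℓ 3≤ℓ (edge-length e01) (edge-length e12) (edge-length e02) (face-2ℓ zero)
  where
  around : ∀ e → 2 * len e + squareLength len e ≡ 2 * ℓ + 2 * ℓ
  around e with faces-through len e
  ... | f , f′ , faces≡ = trans (≡.sym faces≡) (cong₂ _+_ (face-2ℓ f) (face-2ℓ f′))
  around-opposite : ∀ e → 2 * len (opposite e) + squareLength len e ≡ 2 * ℓ + 2 * ℓ
  around-opposite e = subst (λ r → 2 * len (opposite e) + routeLength len (Route.darts r) ≡ 2 * ℓ + 2 * ℓ)
                            (square-opposite e) (around (opposite e))
  edge-length : ∀ e → len e ≡ 1 ⊎ len e ≡ ℓ
  edge-length e = one-or-ℓ (len≥1 e) (around e) (around-opposite e) (square-long e) (square-short e)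

lemma3p2 : (ℓ : ℕ) → 3 ≤ ℓ → {n : ℕ} (G : Graph n) →
    GirthEq G (2 * ℓ) →
    (∀ k → Even k → 2 * ℓ + 2 ≤ k → ¬ Hole G k) →
    ¬ HasEvenFacedInducedSubdivK4 G
lemma3p2 ℓ 3≤ℓ G (_ , girth) no-even-hole (len , (len≥1 , _ , φ-injective , φ-iso) , faces-even) =
  K4-lengths-impossible 3≤ℓ len≥1 face-2ℓ square-long square-short
  where
  open InducedSubdivision G len len≥1 φ-injective φ-iso

  4≤2ℓ : 4 ≤ 2 * ℓ
  4≤2ℓ = ≤-trans (s≤s (s≤s (s≤s (s≤s z≤n)))) (*-monoʳ-≤ 2 3≤ℓ)

  even-induced-≤ : ∀ {k} (C : Cycle G k) → Induced C → Even k → k ≤ 2 * ℓ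
  even-induced-≤ C C-induced k-even =
    even∧≱⇒≤ {ℓ} k-even λ 2ℓ+2≤k → no-even-hole _ k-even 2ℓ+2≤k (≤-trans 4≤2ℓ (girth _ C) , C , C-induced)

  face-2ℓ : ∀ f → faceLength len f ≡ 2 * ℓ
  face-2ℓ f = trans (≡.sym (triangle-length len f)) (≤-antisym
    (even-induced-≤ (routeCycle (triangle f)) (routeCycle-induced (triangle f) (triangle-chordless len f))
                    (subst Even (≡.sym (triangle-length len f)) (faces-even f)))
    (girth _ (routeCycle (triangle f))))

  square-long : ∀ e → 2 * ℓ ≤ squareLength len e
  square-long e = girth _ (routeCycle (square e))

  square-short : ∀ e → 2 ≤ len e → 2 ≤ len (opposite e) → Even (squareLength len e) → squareLength len e ≤ 2 * ℓ
  square-short e 2≤len 2≤len′ =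
    even-induced-≤ (routeCycle (square e)) (routeCycle-induced (square e) (square-chords len e 2≤len 2≤len′))
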